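{- Let $\mathbb F_q$ be a finite field with $q$ odd, and let $F,G\in\mathbb F_q[X]$ be polynomials of degree $2$ such that $F(x)\equiv G(x)\pmod{(\mathbb F_q^{\times})^2}$ for all $x\in\mathbb F_q$, i.e. for every $x\in\mathbb F_q$ either $F(x)=G(x)=0$, or $F(x)G(x)\ne0$ and $F(x)/G(x)\in(\mathbb F_q^\times)^2$. Then $F=u^2G$ for some $u\in\mathbb F_q$. -}

module Defs where

open import Level using (Level; _⊔_; suc)
import Data.Nat as ℕ
open ℕ using (ℕ)
open import Data.Fin using (Fin)
open import Data.Product using (Σ; ∃; _×_; proj₁)
open import Data.Sum using (_⊎_)
open import Relation.Nullary using (¬_)
open import Relation.Binary.PropositionalEquality as ≡ using (_≡_)
open import Function.Bundles using (Bijection)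
open import Algebra.Bundles using (CommutativeRing)

record FiniteField (c ℓ : Level) : Set (suc (c ⊔ ℓ)) where
  field
    commRing : CommutativeRing c ℓ
  open CommutativeRing commRing public
  field
    1≉0     : ¬ (1# ≈ 0#)
    inverse : ∀ x → ¬ (x ≈ 0#) → Σ Carrier (λ y → x * y ≈ 1#)
    order   : ℕ
    enum    : Bijection (≡.setoid (Fin order)) setoid

Odd : ℕ → Set
Odd q = ∃ λ k → q ≡ 1 ℕ.+ 2 ℕ.* k

module _ {c ℓ : Level} (K : FiniteField c ℓ) where
  open FiniteField K

  record Quadratic : Set (c ⊔ ℓ) where
    constructor quad
    field
      a b c₀ : Carrier
      a≉0 : ¬ (a ≈ 0#)

  eval : Quadratic → Carrier → Carrier
  eval (quad a b c₀ _) x = a * (x * x) + b * x + c₀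

  IsNonzeroSquare : Carrier → Set (c ⊔ ℓ)
  IsNonzeroSquare t = ¬ (t ≈ 0#) × Σ Carrier (λ s → t ≈ s * s)

  inv : (y : Carrier) → ¬ (y ≈ 0#) → Carrier
  inv y y≉0 = proj₁ (inverse y y≉0)

  SameSquareClass : Carrier → Carrier → Set (c ⊔ ℓ)
  SameSquareClass s t =
    (s ≈ 0# × t ≈ 0#) ⊎
    (Σ (¬ (s ≈ 0#)) λ _ → Σ (¬ (t ≈ 0#)) λ t≉0 → IsNonzeroSquare (s * inv t t≉0))

  _≈ₚ_scaled_ : Quadratic → Carrier → Quadratic → Set ℓ
  F ≈ₚ u scaled G =
    Quadratic.a F ≈ (u * u) * Quadratic.a G ×
    Quadratic.b F ≈ (u * u) * Quadratic.b G ×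
    Quadratic.c₀ F ≈ (u * u) * Quadratic.c₀ G

-- Odd order rules out characteristic 2, since x ↦ x + 1 would be a fixed-point-free
-- involution of K.
--
-- If G has a root, F and G have the same roots, hence the same second root as well, and
-- Vieta's formulas give F = t G with t the ratio of the leading coefficients. At a point x
-- with G(x) ≠ 0 we also have F(x) = s² G(x), so t = s².
--
-- If G has no root, then F(x) = s_x² G(x) with s_x ≠ 0 for every x. The 2q values ± s_x
-- lie among the q − 1 nonzero elements, so one value v is attained three times, and at three
-- distinct points because s_x ≠ − s_x. Then F − v² G has three roots, so F = v² G.
module Submission where

open import Defs
open import Level using (Level; _⊔_)
open import Function using (_∘_)
open import Function.Bundles using (Bijection; Inverse)
open import Function.Properties.Bijection using (Bijection⇒Inverse)
open import Algebra.Bundles using (CommutativeRing)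
import Algebra.Properties.Group as GroupProperties
import Algebra.Solver.Ring
open import Algebra.Solver.Ring.AlmostCommutativeRing
  using (fromCommutativeRing; _-Raw-AlmostCommutative⟶_)
open import Data.Nat as ℕ using (ℕ; zero; suc)
import Data.Nat.Properties as ℕₚ
open import Algebra.Properties.CommutativeMonoid.Sum ℕₚ.+-0-commutativeMonoid
  using (sum-syntax; sum-cong-≗; ∑-distrib-+; ∑-permute)
open import Data.Fin using (Fin; _<_; punchOut; splitAt; join)
import Data.Fin.Properties as Finₚ
open import Data.Fin.Permutation using (permutation)
open import Data.Maybe using (Maybe; just; nothing)
open import Data.Integer as ℤ using (ℤ; -[1+_]; _⊖_; sign; ∣_∣)
import Data.Integer.Properties as ℤₚ
open import Data.Sign as Sign using (Sign)
open import Data.Product using (Σ; ∃; _×_; _,_; proj₁; proj₂)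
open import Data.Sum as Sum using (_⊎_; inj₁; inj₂; [_,_]′)
import Data.Sum.Properties as Sumₚ
open import Relation.Binary using (Rel; Decidable; tri<; tri≈; tri>)
open import Relation.Nullary using (¬_; Dec; yes; no; contradiction)
open import Relation.Nullary.Decidable using (_×-dec_; map′)
open import Relation.Binary.PropositionalEquality as ≡ using (_≡_; _≢_)

module _ where
  open import Data.Nat using (_+_; _*_)

  ∑-const-1 : ∀ n → ∑[ i < n ] 1 ≡ n
  ∑-const-1 zero    = ≡.refl
  ∑-const-1 (suc n) = ≡.cong suc (∑-const-1 n)

  -- Each orbit {i , σ i} contains exactly one ascent, so n is twice the number of ascents.
  fixedPointFree-involution⇒even : ∀ {n} (σ : Fin n → Fin n) →
    (∀ i → σ (σ i) ≡ i) → (∀ i → σ i ≢ i) → ∃ λ k → n ≡ 2 * k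
  fixedPointFree-involution⇒even {n} σ σ-involutive σ-fixedPointFree = A , (begin
    n                                    ≡⟨ ∑-const-1 n ⟨
    ∑[ i < n ] 1                         ≡⟨ sum-cong-≗ ascent+ascent∘σ≡1 ⟨
    ∑[ i < n ] (ascent i + ascent (σ i)) ≡⟨ ∑-distrib-+ ascent (ascent ∘ σ) ⟩
    A + ∑[ i < n ] ascent (σ i)          ≡⟨ ≡.cong (A +_) (∑-permute ascent σ-permutation) ⟨
    A + A                                ≡⟨ ≡.cong (A +_) (ℕₚ.+-identityʳ A) ⟨
    2 * A                                ∎)
    where
    open ≡.≡-Reasoning

    ascent : Fin n → ℕ
    ascent i with i Finₚ.<? σ i
    ... | yes _ = 1
    ... | no _  = 0

    A = ∑[ i < n ] ascent i

    σ-permutation = permutation σ σ σ-involutive σ-involutive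

    ascent+ascent∘σ≡1 : ∀ i → ascent i + ascent (σ i) ≡ 1
    ascent+ascent∘σ≡1 i with i Finₚ.<? σ i | σ i Finₚ.<? σ (σ i) | Finₚ.<-cmp i (σ i)
    ... | yes _    | no _       | _ = ≡.refl
    ... | no _     | yes _      | _ = ≡.refl
    ... | yes i<σi | yes σi<σσi | _ =
      contradiction (≡.subst (σ i <_) (σ-involutive i) σi<σσi) (Finₚ.<-asym i<σi)
    ... | no i≮σi  | no _       | tri< i<σi _ _ = contradiction i<σi i≮σi
    ... | no _     | no _       | tri≈ _ i≡σi _ =
      contradiction (≡.sym i≡σi) (σ-fixedPointFree i)
    ... | no _     | no σi≮σσi  | tri> _ _ σi<i =
      contradiction (≡.subst (σ i <_) (≡.sym (σ-involutive i)) σi<i) σi≮σσi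

  record Collision₃ {a ℓ} {A : Set a} {n} (_∼_ : Rel A ℓ) (f : Fin n → A) : Set (a ⊔ ℓ) where
    constructor collision₃
    field
      {i j k}   : Fin n
      i<j       : i < j
      j<k       : j < k
      f[i]∼f[j] : f i ∼ f j
      f[j]∼f[k] : f j ∼ f k

  Collision₃-reflect : ∀ {a b ℓ} {A : Set a} {B : Set b} {_∼_ : Rel A ℓ} {n}
    {f : Fin n → A} {g : Fin n → B} →
    (∀ {i j} → g i ≡ g j → f i ∼ f j) → Collision₃ _≡_ g → Collision₃ _∼_ f
  Collision₃-reflect reflect (collision₃ i<j j<k eq₁ eq₂) =
    collision₃ i<j j<k (reflect eq₁) (reflect eq₂)

  -- Tag each index by whether its value already occurred at a smaller index; two indices
  -- with equal tag and value are then either part of a triple or contradict the tagging.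
  pigeonhole₂ : ∀ {m n} → m + m ℕ.< n → (f : Fin n → Fin m) → Collision₃ _≡_ f
  pigeonhole₂ {m} {n} m+m<n f =
    let i , j , i<j , codes≡ = Finₚ.pigeonhole m+m<n code
    in collide i<j (repeated? i) (repeated? j) (join-injective codes≡)
    where
    Repeated : Fin n → Set
    Repeated j = ∃ λ i → i < j × f i ≡ f j

    repeated? : ∀ j → Dec (Repeated j)
    repeated? j = Finₚ.any? λ i → (i Finₚ.<? j) ×-dec (f i Finₚ.≟ f j)

    tag : ∀ {j} → Dec (Repeated j) → Fin m → Fin m ⊎ Fin m
    tag (yes _) = inj₂
    tag (no _)  = inj₁

    code : Fin n → Fin (m + m)
    code j = join m m (tag (repeated? j) (f j))

    join-injective : ∀ {x y} → join m m x ≡ join m m y → x ≡ y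
    join-injective {x} {y} eq = ≡.trans (≡.sym (Finₚ.splitAt-join m m x))
      (≡.trans (≡.cong (splitAt m) eq) (Finₚ.splitAt-join m m y))

    collide : ∀ {i j} → i < j → (ri : Dec (Repeated i)) (rj : Dec (Repeated j)) →
              tag ri (f i) ≡ tag rj (f j) → Collision₃ _≡_ f
    collide i<j (yes (k , k<i , f[k]≡f[i])) (yes _) eq =
      collision₃ k<i i<j f[k]≡f[i] (Sumₚ.inj₂-injective eq)
    collide i<j (no _) (no j-new) eq =
      contradiction (_ , i<j , Sumₚ.inj₁-injective eq) j-new
    collide _ (yes _) (no _) ()
    collide _ (no _) (yes _) ()

  pigeonhole₂-avoiding : ∀ {m n} (z : Fin m) (f : Fin n → Fin m) →
    (∀ i → f i ≢ z) → m + m ℕ.≤ n → Collision₃ _≡_ f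
  pigeonhole₂-avoiding {suc m} z f f≢z 1+m+1+m≤n =
    Collision₃-reflect (Finₚ.punchOut-injective (z≢f _) (z≢f _))
                       (pigeonhole₂ m+m<n λ i → punchOut (z≢f i))
    where
    z≢f : ∀ i → z ≢ f i
    z≢f i = f≢z i ∘ ≡.sym

    m+m<n : m + m ℕ.< _
    m+m<n = ℕₚ.<-≤-trans (ℕ.s≤s (ℕₚ.+-monoʳ-≤ m (ℕₚ.n≤1+n m))) 1+m+1+m≤n

  splitAt-injective : ∀ m {n} {i j : Fin (m + n)} → splitAt m i ≡ splitAt m j → i ≡ j
  splitAt-injective m {n} {i} {j} eq = ≡.trans (≡.sym (Finₚ.join-splitAt m n i))
    (≡.trans (≡.cong (join m n) eq) (Finₚ.join-splitAt m n j))

-- The ring solver compares normal forms by reduction, so its coefficients must compute: we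
-- take them in ℤ, via the canonical map ℤ → R, rather than among the abstract elements of R.
module IntegerCoefficients {c ℓ} (R : CommutativeRing c ℓ) where
  open CommutativeRing R
  open import Algebra.Properties.Semiring.Mult.TCOptimised semiring
    using (1+×; ×-homo-+; ×1-homo-*) renaming (_×_ to _·_)
  open import Algebra.Properties.Ring ring using (-1*x≈-x)
  open import Algebra.Properties.AbelianGroup +-abelianGroup using (⁻¹-∙-comm)
  open import Algebra.Properties.CommutativeSemigroup +-commutativeSemigroup using (x∙yz≈y∙xz)
  open import Algebra.Properties.CommutativeSemigroup *-commutativeSemigroup using (interchange)
  open GroupProperties +-group using (x≈z//y; ⁻¹-involutive; ε⁻¹≈ε)
  open import Relation.Binary.Reasoning.Setoid setoid

  ⟦_⟧ : ℤ → Carrier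
  ⟦ ℤ.+ n ⟧    = n · 1#
  ⟦ -[1+ n ] ⟧ = - (suc n · 1#)

  ⟦m⊖n⟧+n≈m : ∀ m n → ⟦ m ⊖ n ⟧ + n · 1# ≈ m · 1#
  ⟦m⊖n⟧+n≈m m       zero    = +-identityʳ _
  ⟦m⊖n⟧+n≈m zero    (suc n) = -‿inverseˡ _
  ⟦m⊖n⟧+n≈m (suc m) (suc n) = begin
    ⟦ suc m ⊖ suc n ⟧ + suc n · 1# ≡⟨ ≡.cong (λ i → ⟦ i ⟧ + _) (ℤₚ.[1+m]⊖[1+n]≡m⊖n m n) ⟩
    ⟦ m ⊖ n ⟧ + suc n · 1#         ≈⟨ +-congˡ (1+× n 1#) ⟩
    ⟦ m ⊖ n ⟧ + (1# + n · 1#)      ≈⟨ x∙yz≈y∙xz _ _ _ ⟩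
    1# + (⟦ m ⊖ n ⟧ + n · 1#)      ≈⟨ +-congˡ (⟦m⊖n⟧+n≈m m n) ⟩
    1# + m · 1#                    ≈⟨ 1+× m 1# ⟨
    suc m · 1#                     ∎

  ⟦m⊖n⟧ : ∀ m n → ⟦ m ⊖ n ⟧ ≈ m · 1# - n · 1#
  ⟦m⊖n⟧ m n = x≈z//y _ _ _ (⟦m⊖n⟧+n≈m m n)

  +-homo : ∀ i j → ⟦ i ℤ.+ j ⟧ ≈ ⟦ i ⟧ + ⟦ j ⟧
  +-homo -[1+ m ] -[1+ n ] = begin
    - (suc (suc (m ℕ.+ n)) · 1#) ≡⟨ ≡.cong (λ k → - (suc k · 1#)) (ℕₚ.+-suc m n) ⟨
    - ((suc m ℕ.+ suc n) · 1#)   ≈⟨ -‿cong (×-homo-+ 1# (suc m) (suc n)) ⟩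
    - (suc m · 1# + suc n · 1#)  ≈⟨ ⁻¹-∙-comm _ _ ⟨
    ⟦ -[1+ m ] ⟧ + ⟦ -[1+ n ] ⟧  ∎
  +-homo -[1+ m ] (ℤ.+ n)  = trans (⟦m⊖n⟧ n (suc m)) (+-comm _ _)
  +-homo (ℤ.+ m)  -[1+ n ] = ⟦m⊖n⟧ m (suc n)
  +-homo (ℤ.+ m)  (ℤ.+ n)  = ×-homo-+ 1# m n

  -‿homo : ∀ i → ⟦ ℤ.- i ⟧ ≈ - ⟦ i ⟧
  -‿homo -[1+ n ]    = sym (⁻¹-involutive _)
  -‿homo (ℤ.+ zero)  = sym ε⁻¹≈ε
  -‿homo (ℤ.+ suc n) = refl

  ⟦_⟧ˢ : Sign → Carrier
  ⟦ Sign.+ ⟧ˢ = 1#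
  ⟦ Sign.- ⟧ˢ = - 1#

  ⟦s◃n⟧ : ∀ s n → ⟦ s ℤ.◃ n ⟧ ≈ ⟦ s ⟧ˢ * (n · 1#)
  ⟦s◃n⟧ s      zero    = sym (zeroʳ _)
  ⟦s◃n⟧ Sign.+ (suc n) = sym (*-identityˡ _)
  ⟦s◃n⟧ Sign.- (suc n) = sym (-1*x≈-x _)

  ⟦i⟧≈sign*abs : ∀ i → ⟦ i ⟧ ≈ ⟦ sign i ⟧ˢ * (∣ i ∣ · 1#)
  ⟦i⟧≈sign*abs i =
    trans (reflexive (≡.cong ⟦_⟧ (≡.sym (ℤₚ.◃-inverse i)))) (⟦s◃n⟧ (sign i) ∣ i ∣)

  sign-homo : ∀ s t → ⟦ s Sign.* t ⟧ˢ ≈ ⟦ s ⟧ˢ * ⟦ t ⟧ˢ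
  sign-homo Sign.+ t      = sym (*-identityˡ _)
  sign-homo Sign.- Sign.+ = sym (*-identityʳ _)
  sign-homo Sign.- Sign.- = sym (trans (-1*x≈-x (- 1#)) (⁻¹-involutive 1#))

  *-homo : ∀ i j → ⟦ i ℤ.* j ⟧ ≈ ⟦ i ⟧ * ⟦ j ⟧
  *-homo i j = begin
    ⟦ i ℤ.* j ⟧
      ≈⟨ ⟦s◃n⟧ (sign i Sign.* sign j) (∣ i ∣ ℕ.* ∣ j ∣) ⟩
    ⟦ sign i Sign.* sign j ⟧ˢ * ((∣ i ∣ ℕ.* ∣ j ∣) · 1#)
      ≈⟨ *-cong (sign-homo (sign i) (sign j)) (×1-homo-* ∣ i ∣ ∣ j ∣) ⟩
    (⟦ sign i ⟧ˢ * ⟦ sign j ⟧ˢ) * (∣ i ∣ · 1# * ∣ j ∣ · 1#)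
      ≈⟨ interchange _ _ _ _ ⟩
    (⟦ sign i ⟧ˢ * ∣ i ∣ · 1#) * (⟦ sign j ⟧ˢ * ∣ j ∣ · 1#)
      ≈⟨ *-cong (⟦i⟧≈sign*abs i) (⟦i⟧≈sign*abs j) ⟨
    ⟦ i ⟧ * ⟦ j ⟧
      ∎

  homomorphism : ℤ.+-*-rawRing -Raw-AlmostCommutative⟶ fromCommutativeRing R
  homomorphism = record
    { ⟦_⟧ = ⟦_⟧ ; +-homo = +-homo ; *-homo = *-homo ; -‿homo = -‿homo
    ; 0-homo = refl ; 1-homo = refl }

  _≟ᶜ_ : ∀ i j → Maybe (⟦ i ⟧ ≈ ⟦ j ⟧)
  i ≟ᶜ j with i ℤ.≟ j
  ... | yes ≡.refl = just refl
  ... | no _       = nothing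

  open Algebra.Solver.Ring ℤ.+-*-rawRing (fromCommutativeRing R) homomorphism _≟ᶜ_ public
    using (solve; _:=_; _:+_; _:-_; _:*_; :-_; con)

module _ {c ℓ} (R : CommutativeRing c ℓ) where
  open CommutativeRing R

  module DiscreteField
    (inverse : ∀ x → ¬ x ≈ 0# → Σ Carrier λ y → x * y ≈ 1#)
    (_≟_ : Decidable _≈_)
    where

    open GroupProperties +-group using ()
      renaming (x∙y⁻¹≈ε⇒x≈y to x-y≈0⇒x≈y; x≈y⇒x∙y⁻¹≈ε to x≈y⇒x-y≈0)
    open IntegerCoefficients R using (solve; _:=_; _:+_; _:-_; _:*_; :-_; con)
    open import Relation.Binary.Reasoning.Setoid setoid

    x≈0∧y≈0⇒x-y≈0 : ∀ {x y} → x ≈ 0# → y ≈ 0# → x - y ≈ 0#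
    x≈0∧y≈0⇒x-y≈0 x≈0 y≈0 = x≈y⇒x-y≈0 (trans x≈0 (sym y≈0))

    reciprocal : ∀ x → ¬ x ≈ 0# → Carrier
    reciprocal x x≉0 = proj₁ (inverse x x≉0)

    x*reciprocal≈1 : ∀ {x} (x≉0 : ¬ x ≈ 0#) → x * reciprocal x x≉0 ≈ 1#
    x*reciprocal≈1 {x} x≉0 = proj₂ (inverse x x≉0)

    x*y≈0⇒y≈0 : ∀ {x y} → ¬ x ≈ 0# → x * y ≈ 0# → y ≈ 0#
    x*y≈0⇒y≈0 {x} {y} x≉0 x*y≈0 = begin
      y            ≈⟨ *-identityˡ y ⟨
      1# * y       ≈⟨ *-congʳ (x*reciprocal≈1 x≉0) ⟨
      (x * x⁻¹) * y
        ≈⟨ solve 3 (λ x x⁻¹ y → (x :* x⁻¹) :* y := x⁻¹ :* (x :* y)) refl x x⁻¹ y ⟩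
      x⁻¹ * (x * y) ≈⟨ *-congˡ x*y≈0 ⟩
      x⁻¹ * 0#     ≈⟨ zeroʳ x⁻¹ ⟩
      0#           ∎
      where x⁻¹ = reciprocal x x≉0

    x*y≈0⇒x≈0 : ∀ {x y} → ¬ y ≈ 0# → x * y ≈ 0# → x ≈ 0#
    x*y≈0⇒x≈0 {x} {y} y≉0 x*y≈0 = x*y≈0⇒y≈0 y≉0 (trans (*-comm y x) x*y≈0)

    x*y≈0⇒x≈0⊎y≈0 : ∀ {x y} → x * y ≈ 0# → x ≈ 0# ⊎ y ≈ 0#
    x*y≈0⇒x≈0⊎y≈0 {x} x*y≈0 with x ≟ 0#
    ... | yes x≈0 = inj₁ x≈0
    ... | no x≉0  = inj₂ (x*y≈0⇒y≈0 x≉0 x*y≈0)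

    *-cancelʳ-≈ : ∀ {x y z} → ¬ z ≈ 0# → x * z ≈ y * z → x ≈ y
    *-cancelʳ-≈ {x} {y} {z} z≉0 xz≈yz = x-y≈0⇒x≈y x y (x*y≈0⇒x≈0 z≉0 (begin
      (x - y) * z   ≈⟨ solve 3 (λ x y z → (x :- y) :* z := x :* z :- y :* z) refl x y z ⟩
      x * z - y * z ≈⟨ x≈y⇒x-y≈0 xz≈yz ⟩
      0#            ∎))

    x*reciprocal[y]≈z⇒x≈z*y : ∀ {x y z} (y≉0 : ¬ y ≈ 0#) → x * reciprocal y y≉0 ≈ z → x ≈ z * y
    x*reciprocal[y]≈z⇒x≈z*y {x} {y} {z} y≉0 x*y⁻¹≈z = begin
      x             ≈⟨ *-identityʳ x ⟨
      x * 1#        ≈⟨ *-congˡ (x*reciprocal≈1 y≉0) ⟨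
      x * (y * y⁻¹)
        ≈⟨ solve 3 (λ x y y⁻¹ → x :* (y :* y⁻¹) := (x :* y⁻¹) :* y) refl x y y⁻¹ ⟩
      (x * y⁻¹) * y ≈⟨ *-congʳ x*y⁻¹≈z ⟩
      z * y         ∎
      where y⁻¹ = reciprocal y y≉0

    x≈-x⇒x≈0 : ¬ 1# + 1# ≈ 0# → ∀ {x} → x ≈ - x → x ≈ 0#
    x≈-x⇒x≈0 2≉0 {x} x≈-x = x*y≈0⇒y≈0 2≉0 (begin
      (1# + 1#) * x ≈⟨ solve 1 (λ x → (con (ℤ.+ 1) :+ con (ℤ.+ 1)) :* x := x :+ x) refl x ⟩
      x + x         ≈⟨ +-congˡ x≈-x ⟩
      x - x         ≈⟨ -‿inverseʳ x ⟩
      0#            ∎)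

    quadratic : Carrier → Carrier → Carrier → Carrier → Carrier
    quadratic α β γ x = α * (x * x) + β * x + γ

    quadratic-cong : ∀ {α α′ β β′ γ γ′ x x′} → α ≈ α′ → β ≈ β′ → γ ≈ γ′ → x ≈ x′ →
      quadratic α β γ x ≈ quadratic α′ β′ γ′ x′
    quadratic-cong α≈ β≈ γ≈ x≈ = +-cong (+-cong (*-cong α≈ (*-cong x≈ x≈)) (*-cong β≈ x≈)) γ≈

    quadratic-secant : ∀ α β γ y z →
      quadratic α β γ y - quadratic α β γ z ≈ (y - z) * (α * (y + z) + β)
    quadratic-secant = solve 5 (λ α β γ y z →
      (α :* (y :* y) :+ β :* y :+ γ) :- (α :* (z :* z) :+ β :* z :+ γ) :=
      (y :- z) :* (α :* (y :+ z) :+ β)) refl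

    roots⇒secant≈0 : ∀ {α β γ y z} → ¬ y ≈ z →
      quadratic α β γ y ≈ 0# → quadratic α β γ z ≈ 0# → α * (y + z) + β ≈ 0#
    roots⇒secant≈0 {α} {β} {γ} {y} {z} y≉z Q[y]≈0 Q[z]≈0 =
      x*y≈0⇒y≈0 (y≉z ∘ x-y≈0⇒x≈y y z)
        (trans (sym (quadratic-secant α β γ y z)) (x≈0∧y≈0⇒x-y≈0 Q[y]≈0 Q[z]≈0))

    three-roots⇒coefficients≈0 : ∀ {α β γ x₁ x₂ x₃} →
      ¬ x₁ ≈ x₂ → ¬ x₁ ≈ x₃ → ¬ x₂ ≈ x₃ →
      quadratic α β γ x₁ ≈ 0# → quadratic α β γ x₂ ≈ 0# → quadratic α β γ x₃ ≈ 0# →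
      α ≈ 0# × β ≈ 0# × γ ≈ 0#
    three-roots⇒coefficients≈0 {α} {β} {γ} {x₁} {x₂} {x₃}
      x₁≉x₂ x₁≉x₃ x₂≉x₃ Q[x₁]≈0 Q[x₂]≈0 Q[x₃]≈0 = α≈0 , β≈0 , γ≈0
      where
      secant₁₂ = roots⇒secant≈0 x₁≉x₂ Q[x₁]≈0 Q[x₂]≈0
      secant₁₃ = roots⇒secant≈0 x₁≉x₃ Q[x₁]≈0 Q[x₃]≈0

      α≈0 : α ≈ 0#
      α≈0 = x*y≈0⇒x≈0 (x₂≉x₃ ∘ x-y≈0⇒x≈y x₂ x₃) (begin
        α * (x₂ - x₃)
          ≈⟨ solve 5 (λ α β x₁ x₂ x₃ →
               α :* (x₂ :- x₃) := (α :* (x₁ :+ x₂) :+ β) :- (α :* (x₁ :+ x₃) :+ β))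
             refl α β x₁ x₂ x₃ ⟩
        (α * (x₁ + x₂) + β) - (α * (x₁ + x₃) + β)
          ≈⟨ x≈0∧y≈0⇒x-y≈0 secant₁₂ secant₁₃ ⟩
        0#
          ∎)

      β≈0 : β ≈ 0#
      β≈0 = begin
        β                  ≈⟨ solve 2 (λ β s → β := con (ℤ.+ 0) :* s :+ β) refl β (x₁ + x₂) ⟩
        0# * (x₁ + x₂) + β ≈⟨ +-congʳ (*-congʳ α≈0) ⟨
        α * (x₁ + x₂) + β  ≈⟨ secant₁₂ ⟩
        0#                 ∎

      γ≈0 : γ ≈ 0#
      γ≈0 = begin
        γ
          ≈⟨ solve 2 (λ γ x → γ := con (ℤ.+ 0) :* (x :* x) :+ con (ℤ.+ 0) :* x :+ γ) refl γ x₁ ⟩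
        quadratic 0# 0# γ x₁ ≈⟨ quadratic-cong α≈0 β≈0 refl refl ⟨
        quadratic α β γ x₁   ≈⟨ Q[x₁]≈0 ⟩
        0#                   ∎

    quadratic-nonvanishing : ∀ {α β γ} → ¬ 1# + 1# ≈ 0# → ¬ α ≈ 0# →
      ∃ λ x → ¬ quadratic α β γ x ≈ 0#
    quadratic-nonvanishing {α} {β} {γ} 2≉0 α≉0
      with quadratic α β γ 0# ≟ 0# | quadratic α β γ 1# ≟ 0# | quadratic α β γ (- 1#) ≟ 0#
    ... | no Q[0]≉0  | _          | _            = 0# , Q[0]≉0
    ... | yes _      | no Q[1]≉0  | _            = 1# , Q[1]≉0
    ... | yes _      | yes _      | no Q[-1]≉0   = - 1# , Q[-1]≉0
    ... | yes Q[0]≈0 | yes Q[1]≈0 | yes Q[-1]≈0 = contradiction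
      (proj₁ (three-roots⇒coefficients≈0 0≉1 0≉-1 1≉-1 Q[0]≈0 Q[1]≈0 Q[-1]≈0)) α≉0
      where
      1≉0 : ¬ 1# ≈ 0#
      1≉0 1≈0 = 2≉0 (trans (+-cong 1≈0 1≈0) (+-identityʳ 0#))
      0≉1 : ¬ 0# ≈ 1#
      0≉1 = 1≉0 ∘ sym
      0≉-1 : ¬ 0# ≈ - 1#
      0≉-1 0≈-1 = 1≉0 (trans (sym (+-identityʳ 1#)) (trans (+-congˡ 0≈-1) (-‿inverseʳ 1#)))
      1≉-1 : ¬ 1# ≈ - 1#
      1≉-1 = 1≉0 ∘ x≈-x⇒x≈0 2≉0

    Proportional : (t α β γ α′ β′ γ′ : Carrier) → Set ℓ
    Proportional t α β γ α′ β′ γ′ = α ≈ t * α′ × β ≈ t * β′ × γ ≈ t * γ′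

    Proportional-cong : ∀ {t t′ α β γ α′ β′ γ′} → t ≈ t′ →
      Proportional t α β γ α′ β′ γ′ → Proportional t′ α β γ α′ β′ γ′
    Proportional-cong t≈t′ (α≈ , β≈ , γ≈) =
      trans α≈ (*-congʳ t≈t′) , trans β≈ (*-congʳ t≈t′) , trans γ≈ (*-congʳ t≈t′)

    Proportional⇒quadratic : ∀ {t α β γ α′ β′ γ′} → Proportional t α β γ α′ β′ γ′ →
      ∀ x → quadratic α β γ x ≈ t * quadratic α′ β′ γ′ x
    Proportional⇒quadratic {t} {α′ = α′} {β′} {γ′} (α≈ , β≈ , γ≈) x = begin
      quadratic _ _ _ x
        ≈⟨ quadratic-cong α≈ β≈ γ≈ refl ⟩
      quadratic (t * α′) (t * β′) (t * γ′) x
        ≈⟨ solve 5 (λ t α β γ x →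
             (t :* α) :* (x :* x) :+ (t :* β) :* x :+ t :* γ :=
             t :* (α :* (x :* x) :+ β :* x :+ γ))
           refl t α′ β′ γ′ x ⟩
      t * quadratic α′ β′ γ′ x
        ∎

    proportional-at-three-points : ∀ {t α β γ α′ β′ γ′ x₁ x₂ x₃} →
      ¬ x₁ ≈ x₂ → ¬ x₁ ≈ x₃ → ¬ x₂ ≈ x₃ →
      quadratic α β γ x₁ ≈ t * quadratic α′ β′ γ′ x₁ →
      quadratic α β γ x₂ ≈ t * quadratic α′ β′ γ′ x₂ →
      quadratic α β γ x₃ ≈ t * quadratic α′ β′ γ′ x₃ →
      Proportional t α β γ α′ β′ γ′
    proportional-at-three-points {t} {α} {β} {γ} {α′} {β′} {γ′} x₁≉x₂ x₁≉x₃ x₂≉x₃ eq₁ eq₂ eq₃ =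
      let α≈ , β≈ , γ≈ = three-roots⇒coefficients≈0 x₁≉x₂ x₁≉x₃ x₂≉x₃
                           (difference≈0 eq₁) (difference≈0 eq₂) (difference≈0 eq₃)
      in x-y≈0⇒x≈y _ _ α≈ , x-y≈0⇒x≈y _ _ β≈ , x-y≈0⇒x≈y _ _ γ≈
      where
      difference≈0 : ∀ {x} → quadratic α β γ x ≈ t * quadratic α′ β′ γ′ x →
        quadratic (α - t * α′) (β - t * β′) (γ - t * γ′) x ≈ 0#
      difference≈0 {x} eq = trans
        (solve 8 (λ t α β γ α′ β′ γ′ x →
           (α :- t :* α′) :* (x :* x) :+ (β :- t :* β′) :* x :+ (γ :- t :* γ′) :=
           (α :* (x :* x) :+ β :* x :+ γ) :- t :* (α′ :* (x :* x) :+ β′ :* x :+ γ′))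
         refl t α β γ α′ β′ γ′ x)
        (x≈y⇒x-y≈0 eq)

    HasRoots : (α β γ r ρ : Carrier) → Set ℓ
    HasRoots α β γ r ρ = β ≈ - (α * (r + ρ)) × γ ≈ α * (r * ρ)

    HasRoots⇒factorisation : ∀ {α β γ r ρ} → HasRoots α β γ r ρ →
      ∀ x → quadratic α β γ x ≈ α * ((x - r) * (x - ρ))
    HasRoots⇒factorisation {α} {β} {γ} {r} {ρ} (β≈ , γ≈) x = begin
      quadratic α β γ x
        ≈⟨ quadratic-cong refl β≈ γ≈ refl ⟩
      quadratic α (- (α * (r + ρ))) (α * (r * ρ)) x
        ≈⟨ solve 4 (λ α r ρ x →
             α :* (x :* x) :+ :- (α :* (r :+ ρ)) :* x :+ α :* (r :* ρ) :=
             α :* ((x :- r) :* (x :- ρ)))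
           refl α r ρ x ⟩
      α * ((x - r) * (x - ρ))
        ∎

    HasRoots⇒root₂ : ∀ {α β γ r ρ} → HasRoots α β γ r ρ → quadratic α β γ ρ ≈ 0#
    HasRoots⇒root₂ {α} {r = r} {ρ} roots = trans (HasRoots⇒factorisation roots ρ)
      (solve 3 (λ α r ρ → α :* ((ρ :- r) :* (ρ :- ρ)) := con (ℤ.+ 0)) refl α r ρ)

    HasRoots⇒root≈r⊎ρ : ∀ {α β γ r ρ y} → ¬ α ≈ 0# → HasRoots α β γ r ρ →
      quadratic α β γ y ≈ 0# → y ≈ r ⊎ y ≈ ρ
    HasRoots⇒root≈r⊎ρ {y = y} α≉0 roots Q[y]≈0 =
      Sum.map (x-y≈0⇒x≈y _ _) (x-y≈0⇒x≈y _ _) (x*y≈0⇒x≈0⊎y≈0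
        (x*y≈0⇒y≈0 α≉0 (trans (sym (HasRoots⇒factorisation roots y)) Q[y]≈0)))

    root⇒HasRoots : ∀ {α β γ r} → ¬ α ≈ 0# → quadratic α β γ r ≈ 0# →
      ∃ λ ρ → HasRoots α β γ r ρ
    root⇒HasRoots {α} {β} {γ} {r} α≉0 Q[r]≈0 = ρ , β≈ , γ≈
      where
      α⁻¹ = reciprocal α α≉0
      ρ = - (β * α⁻¹) - r

      β≈ : β ≈ - (α * (r + ρ))
      β≈ = sym (begin
        - (α * (r + ρ))
          ≈⟨ solve 4 (λ α α⁻¹ β r → :- (α :* (r :+ (:- (β :* α⁻¹) :- r))) := β :* (α :* α⁻¹))
             refl α α⁻¹ β r ⟩
        β * (α * α⁻¹) ≈⟨ *-congˡ (x*reciprocal≈1 α≉0) ⟩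
        β * 1#        ≈⟨ *-identityʳ β ⟩
        β             ∎)

      γ≈ : γ ≈ α * (r * ρ)
      γ≈ = x-y≈0⇒x≈y _ _ (begin
        γ - α * (r * ρ)
          ≈⟨ solve 5 (λ α β γ r ρ →
               γ :- α :* (r :* ρ) :=
               (α :* (r :* r) :+ β :* r :+ γ) :- r :* (β :- :- (α :* (r :+ ρ))))
             refl α β γ r ρ ⟩
        quadratic α β γ r - r * (β - - (α * (r + ρ)))
          ≈⟨ x≈0∧y≈0⇒x-y≈0 Q[r]≈0 (trans (*-congˡ (x≈y⇒x-y≈0 β≈)) (zeroʳ r)) ⟩
        0#
          ∎)

    HasRoots⇒Proportional : ∀ {t α β γ α′ β′ γ′ r ρ ρ′} →
      HasRoots α β γ r ρ → HasRoots α′ β′ γ′ r ρ′ → ρ ≈ ρ′ → α ≈ t * α′ →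
      Proportional t α β γ α′ β′ γ′
    HasRoots⇒Proportional {t} {α} {β} {γ} {α′} {β′} {γ′} {r} {ρ} {ρ′}
      (β≈ , γ≈) (β′≈ , γ′≈) ρ≈ρ′ α≈tα′ = α≈tα′ , β≈tβ′ , γ≈tγ′
      where
      β≈tβ′ : β ≈ t * β′
      β≈tβ′ = begin
        β                       ≈⟨ β≈ ⟩
        - (α * (r + ρ))         ≈⟨ -‿cong (*-cong α≈tα′ (+-congˡ ρ≈ρ′)) ⟩
        - ((t * α′) * (r + ρ′))
          ≈⟨ solve 3 (λ t α s → :- ((t :* α) :* s) := t :* :- (α :* s)) refl t α′ (r + ρ′) ⟩
        t * - (α′ * (r + ρ′))   ≈⟨ *-congˡ β′≈ ⟨
        t * β′                  ∎

      γ≈tγ′ : γ ≈ t * γ′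
      γ≈tγ′ = begin
        γ                   ≈⟨ γ≈ ⟩
        α * (r * ρ)         ≈⟨ *-cong α≈tα′ (*-congˡ ρ≈ρ′) ⟩
        (t * α′) * (r * ρ′) ≈⟨ *-assoc t α′ (r * ρ′) ⟩
        t * (α′ * (r * ρ′)) ≈⟨ *-congˡ γ′≈ ⟨
        t * γ′              ∎

    commonRoots⇒Proportional : ∀ {α β γ α′ β′ γ′ r} → ¬ α ≈ 0# → ¬ α′ ≈ 0# →
      (∀ {x} → quadratic α β γ x ≈ 0# → quadratic α′ β′ γ′ x ≈ 0#) →
      (∀ {x} → quadratic α′ β′ γ′ x ≈ 0# → quadratic α β γ x ≈ 0#) →
      quadratic α β γ r ≈ 0# →
      ∃ λ t → Proportional t α β γ α′ β′ γ′
    commonRoots⇒Proportional {α} {α′ = α′} {r = r} α≉0 α′≉0 Q⇒Q′ Q′⇒Q Q[r]≈0 =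
      let ρ  , roots  = root⇒HasRoots α≉0 Q[r]≈0
          ρ′ , roots′ = root⇒HasRoots α′≉0 (Q⇒Q′ Q[r]≈0)
          ρ≈ρ′ = second-roots-agree
                   (HasRoots⇒root≈r⊎ρ α′≉0 roots′ (Q⇒Q′ (HasRoots⇒root₂ roots)))
                   (HasRoots⇒root≈r⊎ρ α≉0 roots (Q′⇒Q (HasRoots⇒root₂ roots′)))
      in t , HasRoots⇒Proportional roots roots′ ρ≈ρ′ α≈tα′
      where
      t = α * reciprocal α′ α′≉0

      α≈tα′ : α ≈ t * α′
      α≈tα′ = x*reciprocal[y]≈z⇒x≈z*y α′≉0 refl

      second-roots-agree : ∀ {ρ ρ′} → ρ ≈ r ⊎ ρ ≈ ρ′ → ρ′ ≈ r ⊎ ρ′ ≈ ρ → ρ ≈ ρ′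
      second-roots-agree (inj₂ ρ≈ρ′) _           = ρ≈ρ′
      second-roots-agree (inj₁ _)    (inj₂ ρ′≈ρ) = sym ρ′≈ρ
      second-roots-agree (inj₁ ρ≈r)  (inj₁ ρ′≈r) = trans ρ≈r (sym ρ′≈r)

module FiniteFieldProperties {c ℓ} (K : FiniteField c ℓ) where
  open FiniteField K
  open Inverse (Bijection⇒Inverse enum)
    using (to; from; from-cong; inverseˡ; strictlyInverseˡ; strictlyInverseʳ)
  open GroupProperties +-group using (identityʳ-unique)
  open import Relation.Binary.Reasoning.Setoid setoid

  from-injective : ∀ {x y} → from x ≡ from y → x ≈ y
  from-injective {x} eq = trans (sym (strictlyInverseˡ x)) (inverseˡ eq)

  to-injective : ∀ {i j} → to i ≈ to j → i ≡ j
  to-injective = Bijection.injective enum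

  _≟_ : Decidable _≈_
  x ≟ y = map′ from-injective from-cong (from x Finₚ.≟ from y)

  open DiscreteField commRing inverse _≟_ public

  1+1≉0 : Odd order → ¬ 1# + 1# ≈ 0#
  1+1≉0 (k , order≡1+2k) 1+1≈0 =
    let k′ , order≡2k′ = fixedPointFree-involution⇒even shift shift-involutive shift-fixedPointFree
    in ℕₚ.even≢odd k′ k (≡.trans (≡.sym order≡2k′) order≡1+2k)
    where
    shift : Fin order → Fin order
    shift i = from (to i + 1#)

    shift-involutive : ∀ i → shift (shift i) ≡ i
    shift-involutive i = ≡.trans (from-cong (begin
      to (shift i) + 1# ≈⟨ +-congʳ (strictlyInverseˡ _) ⟩
      to i + 1# + 1#    ≈⟨ +-assoc _ _ _ ⟩
      to i + (1# + 1#)  ≈⟨ +-congˡ 1+1≈0 ⟩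
      to i + 0#         ≈⟨ +-identityʳ _ ⟩
      to i              ∎)) (strictlyInverseʳ i)

    shift-fixedPointFree : ∀ i → shift i ≢ i
    shift-fixedPointFree i shift[i]≡i = 1≉0 (identityʳ-unique (to i) 1# (begin
      to i + 1#    ≈⟨ strictlyInverseˡ _ ⟨
      to (shift i) ≡⟨ ≡.cong to shift[i]≡i ⟩
      to i         ∎))

  hasRoot? : (Q : Quadratic K) → Dec (∃ λ x → eval K Q x ≈ 0#)
  hasRoot? Q = map′ (λ (i , Q[i]≈0) → to i , Q[i]≈0)
    (λ (x , Q[x]≈0) → from x , trans (quadratic-cong refl refl refl (strictlyInverseˡ x)) Q[x]≈0)
    (Finₚ.any? λ i → eval K Q (to i) ≟ 0#)

  nonzero-pigeonhole₂ : ∀ {n} (v : Fin n → Carrier) → (∀ i → ¬ v i ≈ 0#) →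
    order ℕ.+ order ℕ.≤ n → Collision₃ _≈_ v
  nonzero-pigeonhole₂ v v≉0 2q≤n = Collision₃-reflect from-injective
    (pigeonhole₂-avoiding (from 0#) (from ∘ v) (λ i → v≉0 i ∘ from-injective) 2q≤n)

module SquareClass {c ℓ} (K : FiniteField c ℓ) (odd : Odd (FiniteField.order K))
  (F G : Quadratic K) (same : ∀ x → SameSquareClass K (eval K F x) (eval K G x)) where
  open FiniteField K
  open FiniteFieldProperties K
  open Inverse (Bijection⇒Inverse enum) using (to)
  open GroupProperties +-group using (⁻¹-injective; ε⁻¹≈ε)
  open IntegerCoefficients commRing using (solve; _:=_; _:*_; :-_)
  open Quadratic F using (a≉0)
  open Quadratic G using () renaming (a≉0 to a′≉0)

  F≈0⇒G≈0 : ∀ {x} → eval K F x ≈ 0# → eval K G x ≈ 0#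
  F≈0⇒G≈0 {x} F[x]≈0 with same x
  ... | inj₁ (_ , G[x]≈0) = G[x]≈0
  ... | inj₂ (F[x]≉0 , _) = contradiction F[x]≈0 F[x]≉0

  G≈0⇒F≈0 : ∀ {x} → eval K G x ≈ 0# → eval K F x ≈ 0#
  G≈0⇒F≈0 {x} G[x]≈0 with same x
  ... | inj₁ (F[x]≈0 , _)     = F[x]≈0
  ... | inj₂ (_ , G[x]≉0 , _) = contradiction G[x]≈0 G[x]≉0

  F≈square*G : ∀ {x} → ¬ eval K G x ≈ 0# →
    ∃ λ s → ¬ s ≈ 0# × eval K F x ≈ (s * s) * eval K G x
  F≈square*G {x} G[x]≉0 with same x
  ... | inj₁ (_ , G[x]≈0) = contradiction G[x]≈0 G[x]≉0
  ... | inj₂ (_ , G[x]≉0′ , ratio≉0 , s , ratio≈s²) =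
    s , (λ s≈0 → ratio≉0 (trans ratio≈s² (trans (*-congʳ s≈0) (zeroˡ s)))) ,
    x*reciprocal[y]≈z⇒x≈z*y G[x]≉0′ ratio≈s²

  root⇒scaled : ∀ {r} → eval K G r ≈ 0# → Σ Carrier λ u → _≈ₚ_scaled_ K F u G
  root⇒scaled G[r]≈0 =
    let t , F≈tG = commonRoots⇒Proportional a≉0 a′≉0 F≈0⇒G≈0 G≈0⇒F≈0 (G≈0⇒F≈0 G[r]≈0)
        x , G[x]≉0 = quadratic-nonvanishing {β = Quadratic.b G} {Quadratic.c₀ G} (1+1≉0 odd) a′≉0
        s , _ , F[x]≈s²G[x] = F≈square*G G[x]≉0
        t≈s² = *-cancelʳ-≈ G[x]≉0 (trans (sym (Proportional⇒quadratic F≈tG x)) F[x]≈s²G[x])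
    in s , Proportional-cong t≈s² F≈tG

  module _ (G≉0 : ∀ x → ¬ eval K G x ≈ 0#) where
    sqrt : Carrier → Carrier
    sqrt x = proj₁ (F≈square*G (G≉0 x))

    sqrt≉0 : ∀ x → ¬ sqrt x ≈ 0#
    sqrt≉0 x = proj₁ (proj₂ (F≈square*G (G≉0 x)))

    F≈sqrt²G : ∀ x → eval K F x ≈ (sqrt x * sqrt x) * eval K G x
    F≈sqrt²G x = proj₂ (proj₂ (F≈square*G (G≉0 x)))

    point : Fin order ⊎ Fin order → Carrier
    point = [ to , to ]′

    signedSqrt : Fin order ⊎ Fin order → Carrier
    signedSqrt (inj₁ i) = sqrt (to i)
    signedSqrt (inj₂ i) = - sqrt (to i)

    signedSqrt≉0 : ∀ d → ¬ signedSqrt d ≈ 0#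
    signedSqrt≉0 (inj₁ i)       = sqrt≉0 (to i)
    signedSqrt≉0 (inj₂ i) -s≈0 = sqrt≉0 (to i) (⁻¹-injective (trans -s≈0 (sym ε⁻¹≈ε)))

    F≈signedSqrt²G : ∀ d →
      eval K F (point d) ≈ (signedSqrt d * signedSqrt d) * eval K G (point d)
    F≈signedSqrt²G (inj₁ i) = F≈sqrt²G (to i)
    F≈signedSqrt²G (inj₂ i) = trans (F≈sqrt²G (to i))
      (*-congʳ (solve 1 (λ s → s :* s := :- s :* :- s) refl (sqrt (to i))))

    signedSqrt-separates : ∀ {d d′} → d ≢ d′ → signedSqrt d ≈ signedSqrt d′ →
      ¬ point d ≈ point d′
    signedSqrt-separates {inj₁ i} {inj₁ j} d≢d′ _ p = d≢d′ (≡.cong inj₁ (to-injective p))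
    signedSqrt-separates {inj₂ i} {inj₂ j} d≢d′ _ p = d≢d′ (≡.cong inj₂ (to-injective p))
    signedSqrt-separates {inj₁ i} {inj₂ j} _ s≈-s p with to-injective p
    ... | ≡.refl = sqrt≉0 (to i) (x≈-x⇒x≈0 (1+1≉0 odd) s≈-s)
    signedSqrt-separates {inj₂ i} {inj₁ j} _ -s≈s p with to-injective p
    ... | ≡.refl = sqrt≉0 (to i) (x≈-x⇒x≈0 (1+1≉0 odd) (sym -s≈s))

    collision⇒scaled : Collision₃ _≈_ (signedSqrt ∘ splitAt order) →
      Σ Carrier λ u → _≈ₚ_scaled_ K F u G
    collision⇒scaled (collision₃ {i} {j} {k} i<j j<k vᵢ≈vⱼ vⱼ≈vₖ) =
      v j , proportional-at-three-points
              (separated i<j vᵢ≈vⱼ)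
              (separated (Finₚ.<-trans i<j j<k) (trans vᵢ≈vⱼ vⱼ≈vₖ))
              (separated j<k vⱼ≈vₖ)
              (F≈vⱼ²G vᵢ≈vⱼ) (F≈vⱼ²G refl) (F≈vⱼ²G (sym vⱼ≈vₖ))
      where
      v = signedSqrt ∘ splitAt order
      p = point ∘ splitAt order

      separated : ∀ {l m} → l < m → v l ≈ v m → ¬ p l ≈ p m
      separated l<m = signedSqrt-separates (Finₚ.<⇒≢ l<m ∘ splitAt-injective order)

      F≈vⱼ²G : ∀ {l} → v l ≈ v j → eval K F (p l) ≈ (v j * v j) * eval K G (p l)
      F≈vⱼ²G {l} vₗ≈vⱼ =
        trans (F≈signedSqrt²G (splitAt order l)) (*-congʳ (*-cong vₗ≈vⱼ vₗ≈vⱼ))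

    rootFree⇒scaled : Σ Carrier λ u → _≈ₚ_scaled_ K F u G
    rootFree⇒scaled = collision⇒scaled
      (nonzero-pigeonhole₂ (signedSqrt ∘ splitAt order) (signedSqrt≉0 ∘ splitAt order) ℕₚ.≤-refl)

lemma6p8 : {c ℓ : Level} (K : FiniteField c ℓ) → Odd (FiniteField.order K) →
    (F G : Quadratic K) →
    (∀ x → SameSquareClass K (eval K F x) (eval K G x)) →
    Σ (FiniteField.Carrier K) (λ u → _≈ₚ_scaled_ K F u G)
lemma6p8 K odd F G same with FiniteFieldProperties.hasRoot? K G
... | yes (_ , G[r]≈0) = SquareClass.root⇒scaled K odd F G same G[r]≈0
... | no root-free      =
  SquareClass.rootFree⇒scaled K odd F G same λ x G[x]≈0 → root-free (x , G[x]≈0)
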